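{- For pairwise distinct colors $c_1,\dots,c_t$, $E\big(\mathrm{tr}(\mathcal S_{(c_1,\dots,c_t)})/d\big)$ equals the number of $(c_1,\dots,c_t)$-compatible maps $f:E(\vec H)\to E(\vec G)$ that induce injective homomorphisms from $\vec H$ to $\vec G$.
   Context: $H$ is a connected finite simple graph with no leaves, vertices $1,\dots,t$, $k$ edges, oriented arbitrarily as $\vec H$ with directed edges $\overrightarrow{a_1a_2},\dots,\overrightarrow{a_{2k-1}a_{2k}}$. $\Gamma(b)=\{i:a_i=b\}$; a distinguished index $\iota(b)\in\Gamma(b)$ is fixed. $G$ is a finite simple graph; $\vec G$ replaces each edge $vw$ by $\overrightarrow{vw},\overrightarrow{wv}$. $\mathcal G$ is a finite group of $d\times d$ complex diagonal matrices averaging to the zero matrix; $I$ the identity. Hash functions $\mathcal X_i:V(G)\to\mathcal G$ ($1\le i\le 2k$): non-distinguished ones chosen independently and uniformly from a $4k$-wise independent family with uniform values; for $i=\iota(b)$, $\mathcal X_i(v)=\prod_{j\in\Gamma(b),j\ne i}\mathcal X_j(v)^{ -1}$ ($=I$ if $\Gamma(b)=\{i\}$). $\mathcal M_i(\overrightarrow{vw})=\mathcal X_{2i-1}(v)\mathcal X_{2i}(w)$. A coloring $\mathcal C:V(G)\to\{1,\dots,C\}$, $C\ge t$, is chosen from a $4k$-wise independent family with uniform values. A map $f$ sending each $\overrightarrow{a_{2i-1}a_{2i}}$ to $\overrightarrow{v_{2i-1}v_{2i}}$ is $(c_1,\dots,c_t)$-compatible if $\mathcal C(v_i)=c_{a_i}$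 for all $1\le i\le 2k$; it induces a homomorphism if $v_i=v_j$ whenever $a_i=a_j$, and an injective homomorphism if moreover $v_i\neq v_j$ whenever $a_i\ne a_j$. $\mathcal Z_i^{c,c'}=\sum\mathcal M_i(\overrightarrow{vw})$ over edges $\overrightarrow{vw}$ of $\vec G$ with $\mathcal C(v)=c,\mathcal C(w)=c'$, and $\mathcal S_{(c_1,\dots,c_t)}=\prod_{i=1}^k\mathcal Z_i^{c_{a_{2i-1}},c_{a_{2i}}}$. $E$ is the expectation over the hash functions $\mathcal X_i$ (with the coloring fixed or random). -}

module Defs where

open import Level using (_⊔_)
open import Data.Nat using (ℕ; zero; suc; _≤_)
import Data.Nat as ℕ
open import Data.Fin using (Fin; zero; suc)
open import Data.Fin.Properties using (_≟_; all?)
open import Data.Product using (Σ; _×_; _,_; proj₁; proj₂)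
open import Data.Product.Properties using (≡-dec)
open import Data.Sum using (_⊎_)
open import Data.List using (List; []; _∷_; _++_; length; filter; allFin; concatMap; map; foldr; cartesianProduct)
import Data.Bool.Properties
open import Data.Bool using (Bool; true; false; if_then_else_; _∧_)
open import Relation.Binary.PropositionalEquality using (_≡_; _≢_)
open import Relation.Nullary using (Dec; yes; no; ¬_; does)
open import Relation.Nullary.Decidable using (_×-dec_; ¬?; _→-dec_)
open import Algebra.Bundles using (CommutativeRing)

-- The oriented pattern graph  H⃗ : vertices Fin t, k directed edges,
-- edge i is  a_{2i-1} → a_{2i}  with  a_{2i-1} = src i, a_{2i} = tgt i.

record OrientedGraph : Set where
  field
    t k : ℕ
    src tgt : Fin k → Fin t

module _ (H : OrientedGraph) where
  open OrientedGraph H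

  -- endpoint indices 1..2k :  (i , 0) ↔ 2i-1 (tail of edge i),  (i , 1) ↔ 2i (head)
  End : Set
  End = Fin k × Fin 2

  endpt : End → Fin t
  endpt (i , zero) = src i
  endpt (i , suc zero) = tgt i

  allEnds : List End
  allEnds = concatMap (λ i → (i , zero) ∷ (i , suc zero) ∷ []) (allFin k)

  Γ : Fin t → List End
  Γ b = filter (λ e → endpt e ≟ b) allEnds

  degree : Fin t → ℕ
  degree b = length (Γ b)

  IsSimple : Set
  IsSimple = (∀ i → src i ≢ tgt i)
           × (∀ i j → i ≢ j → ¬ ((src i ≡ src j × tgt i ≡ tgt j) ⊎ (src i ≡ tgt j × tgt i ≡ src j)))

  data Adjacent : Fin t → Fin t → Set where
    fwd : ∀ i → Adjacent (src i) (tgt i)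
    bwd : ∀ i → Adjacent (tgt i) (src i)

  data Reach : Fin t → Fin t → Set where
    here : ∀ {b} → Reach b b
    step : ∀ {b b′ b″} → Adjacent b b′ → Reach b′ b″ → Reach b b″

  Connected : Set
  Connected = ∀ b b′ → Reach b b′

  NoLeaves : Set
  NoLeaves = ∀ b → degree b ≢ 1

  Distinguished : Set
  Distinguished = (b : Fin t) → Σ End (λ e → endpt e ≡ b)

_≟E_ : ∀ {k} → (e e′ : Fin k × Fin 2) → Dec (e ≡ e′)
_≟E_ = ≡-dec _≟_ _≟_

-- The host graph G : finite simple graph on Fin n.
-- Directed edges of G⃗ are the ordered pairs (v , w) with adj v w ≡ true.

record SimpleGraph : Set where
  field
    n : ℕ
    adj : Fin n → Fin n → Bool
    adj-sym : ∀ v w → adj v w ≡ adj w v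
    adj-irrefl : ∀ v → adj v v ≡ false

countFin : ∀ {p} (N : ℕ) {P : Fin N → Set p} → ((i : Fin N) → Dec (P i)) → ℕ
countFin N P? = length (filter P? (allFin N))

allFuns : ∀ {a} {A : Set a} (N : ℕ) → List A → List (Fin N → A)
allFuns zero xs = (λ ()) ∷ []
allFuns (suc N) xs =
  concatMap (λ x → map (λ h → λ { zero → x ; (suc i) → h i }) (allFuns N xs)) xs

module WithRing {c ℓ} (R : CommutativeRing c ℓ) where
  open CommutativeRing R using (Carrier; _≈_; _+_; _*_; 0#; 1#)

  sumFin : (N : ℕ) → (Fin N → Carrier) → Carrier
  sumFin zero f = 0#
  sumFin (suc N) f = f zero + sumFin N (λ i → f (suc i))

  prodFin : (N : ℕ) → (Fin N → Carrier) → Carrier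
  prodFin zero f = 1#
  prodFin (suc N) f = f zero * prodFin N (λ i → f (suc i))

  sumFun : ∀ {a} {A : Set a} (N : ℕ) → ((A → Carrier) → Carrier) → ((Fin N → A) → Carrier) → Carrier
  sumFun zero sumA F = F (λ ())
  sumFun (suc N) sumA F =
    sumA (λ x → sumFun N sumA (λ h → F (λ { zero → x ; (suc i) → h i })))

  natR : ℕ → Carrier
  natR zero = 0#
  natR (suc N) = 1# + natR N

  -- A finite group 𝒢 of d×d diagonal matrices: element x ∈ Fin m is the matrix
  -- diag(elem x 0, …, elem x (d-1)); matrix operations are entrywise on diagonals.
  record DiagGroup (d : ℕ) : Set (c ⊔ ℓ) where
    field
      m : ℕ
      elem : Fin m → Fin d → Carrier
      elem-inj : ∀ x y → (∀ j → elem x j ≈ elem y j) → x ≡ y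
      one : Fin m
      mul : Fin m → Fin m → Fin m
      inv : Fin m → Fin m
      elem-one : ∀ j → elem one j ≈ 1#
      elem-mul : ∀ x y j → elem (mul x y) j ≈ elem x j * elem y j
      elem-inv : ∀ x j → elem x j * elem (inv x) j ≈ 1#
      average-zero : ∀ j → sumFin m (λ x → elem x j) ≈ 0#

  module _ {d : ℕ} (𝒢 : DiagGroup d) where
    open DiagGroup 𝒢

    -- A family (multiset, drawn uniformly) of s functions V → 𝒢 is K-wise independent
    -- with uniform values: for any r ≤ K distinct vertices and any prescribed values,
    -- exactly a 1/m^r fraction of the family takes these values.
    IndependentFamily : (K nV s : ℕ) → (Fin s → Fin nV → Fin m) → Set
    IndependentFamily K nV s fam =
      ∀ r → r ≤ K → (vs : Fin r → Fin nV) → (∀ l l′ → vs l ≡ vs l′ → l ≡ l′) →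
      (gs : Fin r → Fin m) →
      countFin s (λ ω → all? (λ l → fam ω (vs l) ≟ gs l)) ℕ.* (m ℕ.^ r) ≡ s

    module _ (H : OrientedGraph) (ι : Distinguished H) (G : SimpleGraph)
             {s : ℕ} (fam : Fin s → Fin (SimpleGraph.n G) → Fin m)
             {C : ℕ} (col : Fin (SimpleGraph.n G) → Fin C) where
      open OrientedGraph H
      open SimpleGraph G

      -- ω e ∈ Fin s is the member of the family chosen for the hash function 𝒳_e.
      -- The hash functions 𝒳_e : V(G) → 𝒢 (as indices into 𝒢):
      hash : (End H → Fin s) → End H → Fin n → Fin m
      hash ω e v with e ≟E proj₁ (ι (endpt H e))
      ... | yes _ = foldr mul one
                      (map (λ e′ → inv (fam (ω e′) v))
                           (filter (λ e′ → ¬? (e′ ≟E e)) (Γ H (endpt H e))))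
      ... | no _ = fam (ω e) v

      𝓜 : (End H → Fin s) → Fin k → Fin n → Fin n → Fin d → Carrier
      𝓜 ω i v w j = elem (hash ω (i , zero) v) j * elem (hash ω (i , suc zero) w) j

      𝒵 : (End H → Fin s) → Fin k → Fin C → Fin C → Fin d → Carrier
      𝒵 ω i c₁ c₂ j = sumFin n (λ v → sumFin n (λ w →
        if adj v w ∧ does (col v ≟ c₁) ∧ does (col w ≟ c₂) then 𝓜 ω i v w j else 0#))

      𝒮 : (End H → Fin s) → (Fin t → Fin C) → Fin d → Carrier
      𝒮 ω cs j = prodFin k (λ i → 𝒵 ω i (cs (src i)) (cs (tgt i)) j)

      tr𝒮 : (End H → Fin s) → (Fin t → Fin C) → Carrier
      tr𝒮 ω cs = sumFin d (𝒮 ω cs)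

      -- Σ over all choices ω : {1..2k} → family of tr 𝒮.  (The choices at
      -- distinguished indices are unused, so  E(tr 𝒮) = sumTr𝒮 / s^(2k).)
      sumTr𝒮 : (Fin t → Fin C) → Carrier
      sumTr𝒮 cs = sumFun k (λ F → sumFun 2 (sumFin s) F) (λ ω′ → tr𝒮 (λ e → ω′ (proj₁ e) (proj₂ e)) cs)

-- maps f : E(H⃗) → E(G⃗) : edge i ↦ (f i) = (v_{2i-1} , v_{2i})
module _ (H : OrientedGraph) (G : SimpleGraph) {C : ℕ}
         (col : Fin (SimpleGraph.n G) → Fin C) (cs : Fin (OrientedGraph.t H) → Fin C) where
  open OrientedGraph H
  open SimpleGraph G

  vert : (Fin k → Fin n × Fin n) → End H → Fin n
  vert f (i , zero) = proj₁ (f i)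
  vert f (i , suc zero) = proj₂ (f i)

  LandsInG : (Fin k → Fin n × Fin n) → Set
  LandsInG f = ∀ i → adj (proj₁ (f i)) (proj₂ (f i)) ≡ true

  Compatible : (Fin k → Fin n × Fin n) → Set
  Compatible f = ∀ i p → col (vert f (i , p)) ≡ cs (endpt H (i , p))

  InducesInjHom : (Fin k → Fin n × Fin n) → Set
  InducesInjHom f = ∀ i p i′ p′ →
      (endpt H (i , p) ≡ endpt H (i′ , p′) → vert f (i , p) ≡ vert f (i′ , p′))
    × (endpt H (i , p) ≢ endpt H (i′ , p′) → vert f (i , p) ≢ vert f (i′ , p′))

  Good : (Fin k → Fin n × Fin n) → Set
  Good f = LandsInG f × Compatible f × InducesInjHom f

  good? : (f : Fin k → Fin n × Fin n) → Dec (Good f)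
  good? f =
    all? (λ i → Data.Bool.Properties._≟_ (adj (proj₁ (f i)) (proj₂ (f i))) true)
    ×-dec all? (λ i → all? (λ p → col (vert f (i , p)) ≟ cs (endpt H (i , p))))
    ×-dec all? (λ i → all? (λ p → all? (λ i′ → all? (λ p′ →
            (endpt H (i , p) ≟ endpt H (i′ , p′) →-dec vert f (i , p) ≟ vert f (i′ , p′))
      ×-dec (¬? (endpt H (i , p) ≟ endpt H (i′ , p′)) →-dec ¬? (vert f (i , p) ≟ vert f (i′ , p′)))))))

  numGood : ℕ
  numGood = length (filter good? (allFuns k (cartesianProduct (allFin n) (allFin n))))

-- Expanding the product of the 𝒵's writes tr 𝒮 as a sum over maps f sending every edge of H⃗
-- to a correctly coloured edge of G⃗, of (diagonal entries of) products ∏ₑ 𝒳ₑ(vₑ) of hash values.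
-- As 𝒳_ι(b) is the inverse of the product of the other hashes at b, such a product equals
-- ∏ 𝒳ₑ(vₑ) 𝒳ₑ(v_ι(e))⁻¹ over the non-distinguished e, whose hashes are chosen independently,
-- so the average factorises. A factor with vₑ = v_ι(e) is I; otherwise 2-wise independence
-- makes (𝒳ₑ(vₑ), 𝒳ₑ(v_ι(e))) uniform on 𝒢², and the factor averages to 0 because 𝒢 does.
-- Thus f contributes d exactly when it induces a homomorphism, and since the colours
-- c₁, …, c_t are distinct, a compatible homomorphism is automatically injective.

module Submission where

open import Defs
open import Level using (Level; _⊔_)
open import Data.Nat using (ℕ; zero; suc; _≤_)
import Data.Nat as ℕ
import Data.Nat.Properties as ℕₚ
open import Data.Fin using (Fin; zero; suc)
open import Data.Fin.Properties using (_≟_; all?; ¬∀⟶∃¬; nonZeroIndex)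
open import Data.Bool using (true; false; if_then_else_; T)
open import Data.Bool.Properties using (if-∧; if-swap-then; T-≡)
open import Data.Product using (_×_; _,_; proj₁; proj₂)
open import Data.Product.Properties using (≡-dec; ,-injective)
open import Data.List using (List; []; _∷_; _++_; map; foldr; concatMap; filter; length; tabulate; allFin; cartesianProduct)
open import Function using (_∘_; _⇔_; mk⇔; Equivalence)
open import Function.Definitions using (Injective)
open import Relation.Nullary using (Dec; yes; no; does; contradiction)
open import Relation.Nullary.Decidable using (¬?; _×-dec_; T?; dec-true; dec-false; does-⇔)
open import Relation.Binary.PropositionalEquality as ≡ using (_≡_; _≢_)
open import Algebra.Bundles using (Monoid; CommutativeRing)
import Algebra.Properties.Monoid.Sum as MonoidSum
import Algebra.Properties.Semiring.Sum as SemiringSum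
import Algebra.Properties.Semiring.Mult as SemiringMult
import Algebra.Properties.CommutativeMonoid.Sum as CommutativeMonoidSum

module MonoidSums {a ℓ} (M : Monoid a ℓ) where
  open Monoid M
  open MonoidSum M using (sum; sum-replicate-zero)

  sum-δ : ∀ {n} (i₀ : Fin n) (f : Fin n → Carrier) →
          sum (λ i → if does (i ≟ i₀) then f i else ε) ≈ f i₀
  sum-δ {suc n} zero    f = trans (∙-congˡ (sum-replicate-zero n)) (identityʳ _)
  sum-δ {suc n} (suc i₀) f = trans (identityˡ _) (sum-δ i₀ (f ∘ suc))

  sumList : ∀ {A : Set} → List A → (A → Carrier) → Carrier
  sumList xs f = foldr (λ x → f x ∙_) ε xs

  sumList-cong : ∀ {A : Set} (xs : List A) {f g} → (∀ x → f x ≈ g x) → sumList xs f ≈ sumList xs g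
  sumList-cong []       f≈g = refl
  sumList-cong (x ∷ xs) f≈g = ∙-cong (f≈g x) (sumList-cong xs f≈g)

  sumList-++ : ∀ {A : Set} (xs ys : List A) f → sumList (xs ++ ys) f ≈ sumList xs f ∙ sumList ys f
  sumList-++ []       ys f = sym (identityˡ _)
  sumList-++ (x ∷ xs) ys f = trans (∙-congˡ (sumList-++ xs ys f)) (sym (assoc _ _ _))

  sumList-map : ∀ {A B : Set} (g : A → B) (xs : List A) f → sumList (map g xs) f ≈ sumList xs (f ∘ g)
  sumList-map g []       f = refl
  sumList-map g (x ∷ xs) f = ∙-congˡ (sumList-map g xs f)

  sumList-concatMap : ∀ {A B : Set} (h : A → List B) (xs : List A) f →
                      sumList (concatMap h xs) f ≈ sumList xs (λ x → sumList (h x) f)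
  sumList-concatMap h []       f = refl
  sumList-concatMap h (x ∷ xs) f =
    trans (sumList-++ (h x) (concatMap h xs) f) (∙-congˡ (sumList-concatMap h xs f))

  sumList-tabulate : ∀ {A : Set} N (τ : Fin N → A) f → sumList (tabulate τ) f ≈ sum (f ∘ τ)
  sumList-tabulate zero    τ f = refl
  sumList-tabulate (suc N) τ f = ∙-congˡ (sumList-tabulate N (τ ∘ suc) f)

  sumList-filter : ∀ {A : Set} {p} {Q : A → Set p} (Q? : ∀ x → Dec (Q x)) (xs : List A) f →
                   sumList (filter Q? xs) f ≈ sumList xs (λ x → if does (Q? x) then f x else ε)
  sumList-filter Q? []       f = refl
  sumList-filter Q? (x ∷ xs) f with does (Q? x)
  ... | true  = ∙-congˡ (sumList-filter Q? xs f)
  ... | false = trans (sumList-filter Q? xs f) (sym (identityˡ _))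

module BigOperators {c ℓ} (R : CommutativeRing c ℓ) where
  open CommutativeRing R hiding (zero)
  open WithRing R
  open MonoidSums +-monoid using (sumList; sumList-cong; sumList-++; sumList-map; sumList-concatMap)
  module ∏List = MonoidSums *-monoid
  open import Relation.Binary.Reasoning.Setoid setoid
  module ∑ = SemiringSum semiring
  module ∏ = CommutativeMonoidSum *-commutativeMonoid
  open SemiringMult semiring using (×1-homo-*; ×-assoc-*; ×-congʳ) renaming (_×_ to _·_)

  natR≡×1# : ∀ n → natR n ≡ n · 1#
  natR≡×1# zero    = ≡.refl
  natR≡×1# (suc n) = ≡.cong (1# +_) (natR≡×1# n)

  natR-* : ∀ m n → natR (m ℕ.* n) ≈ natR m * natR n
  natR-* m n rewrite natR≡×1# (m ℕ.* n) | natR≡×1# m | natR≡×1# n = ×1-homo-* m n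

  sumFin≈∑ : ∀ N {f g : Fin N → Carrier} → (∀ i → f i ≈ g i) → sumFin N f ≈ ∑.sum g
  sumFin≈∑ zero    f≈g = refl
  sumFin≈∑ (suc N) f≈g = +-cong (f≈g zero) (sumFin≈∑ N (f≈g ∘ suc))

  prodFin≈∏ : ∀ N {f g : Fin N → Carrier} → (∀ i → f i ≈ g i) → prodFin N f ≈ ∏.sum g
  prodFin≈∏ zero    f≈g = refl
  prodFin≈∏ (suc N) f≈g = *-cong (f≈g zero) (prodFin≈∏ N (f≈g ∘ suc))

  sumFin-cong : ∀ N {f g} → (∀ i → f i ≈ g i) → sumFin N f ≈ sumFin N g
  sumFin-cong N f≈g = trans (sumFin≈∑ N f≈g) (sym (sumFin≈∑ N (λ _ → refl)))

  prodFin-cong : ∀ N {f g} → (∀ i → f i ≈ g i) → prodFin N f ≈ prodFin N g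
  prodFin-cong N f≈g = trans (prodFin≈∏ N f≈g) (sym (prodFin≈∏ N (λ _ → refl)))

  sumFin-const : ∀ N a → sumFin N (λ _ → a) ≈ natR N * a
  sumFin-const N a = begin
    sumFin N (λ _ → a)  ≈⟨ sumFin≈∑ N (λ _ → refl) ⟩
    ∑.sum {N} (λ _ → a) ≈⟨ ∑.sum-replicate N ⟩
    N · a               ≈⟨ ×-congʳ N (*-identityˡ a) ⟨
    N · (1# * a)        ≈⟨ ×-assoc-* N 1# a ⟨
    (N · 1#) * a        ≡⟨ ≡.cong (_* a) (natR≡×1# N) ⟨
    natR N * a          ∎

  sumFin-δ : ∀ N (i₀ : Fin N) f → sumFin N (λ i → if does (i ≟ i₀) then f i else 0#) ≈ f i₀
  sumFin-δ N i₀ f = trans (sumFin≈∑ N (λ _ → refl)) (MonoidSums.sum-δ +-monoid i₀ f)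

  prodFin-δ : ∀ N (i₀ : Fin N) f → prodFin N (λ i → if does (i ≟ i₀) then f i else 1#) ≈ f i₀
  prodFin-δ N i₀ f = trans (prodFin≈∏ N (λ _ → refl)) (MonoidSums.sum-δ *-monoid i₀ f)

  prodFin-* : ∀ N f g → prodFin N (λ i → f i * g i) ≈ prodFin N f * prodFin N g
  prodFin-* N f g = begin
    prodFin N (λ i → f i * g i)  ≈⟨ prodFin≈∏ N (λ _ → refl) ⟩
    ∏.sum (λ i → f i * g i)      ≈⟨ ∏.∑-distrib-+ f g ⟩
    ∏.sum f * ∏.sum g            ≈⟨ *-cong (prodFin≈∏ N (λ _ → refl)) (prodFin≈∏ N (λ _ → refl)) ⟨
    prodFin N f * prodFin N g    ∎

  prodFin-comm : ∀ M N (f : Fin M → Fin N → Carrier) →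
                 prodFin M (λ i → prodFin N (f i)) ≈ prodFin N (λ j → prodFin M (λ i → f i j))
  prodFin-comm M N f = begin
    prodFin M (λ i → prodFin N (f i))           ≈⟨ prodFin≈∏ M (λ i → prodFin≈∏ N (λ _ → refl)) ⟩
    ∏.sum (λ i → ∏.sum (f i))                   ≈⟨ ∏.∑-comm f ⟩
    ∏.sum (λ j → ∏.sum (λ i → f i j))           ≈⟨ prodFin≈∏ N (λ j → prodFin≈∏ M (λ _ → refl)) ⟨
    prodFin N (λ j → prodFin M (λ i → f i j))   ∎

  prodFin-const : ∀ N m → prodFin N (λ _ → natR m) ≈ natR (m ℕ.^ N)
  prodFin-const zero    m = sym (+-identityʳ 1#)
  prodFin-const (suc N) m = trans (*-congˡ (prodFin-const N m)) (sym (natR-* m (m ℕ.^ N)))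

  prodFin-zero : ∀ N f (i : Fin N) → f i ≈ 0# → prodFin N f ≈ 0#
  prodFin-zero (suc N) f zero    fi≈0 = trans (*-congʳ fi≈0) (zeroˡ _)
  prodFin-zero (suc N) f (suc i) fi≈0 = trans (*-congˡ (prodFin-zero N (f ∘ suc) i fi≈0)) (zeroʳ _)

  prodFin-indicator : ∀ N {p} {P : Fin N → Set p} (P? : ∀ i → Dec (P i)) f →
               prodFin N (λ i → if does (P? i) then f i else 0#)
                 ≈ (if does (all? P?) then prodFin N f else 0#)
  prodFin-indicator N {P = P} P? f = go (all? P?)
    where
    go : (∀P? : Dec (∀ i → P i)) →
         prodFin N (λ i → if does (P? i) then f i else 0#) ≈ (if does ∀P? then prodFin N f else 0#)
    go (yes ∀P) = prodFin-cong N (λ i → reflexive (≡.cong (if_then f i else 0#) (dec-true (P? i) (∀P i))))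
    go (no ¬∀P) with ¬∀⟶∃¬ N _ P? ¬∀P
    ... | i , ¬Pi = prodFin-zero N _ i (reflexive (≡.cong (if_then f i else 0#) (dec-false (P? i) ¬Pi)))

  -- For N = 2 this is definitionally the _≟E_ used in the definition of hash.
  _≟²_ : ∀ {M N} (e e′ : Fin M × Fin N) → Dec (e ≡ e′)
  _≟²_ = ≡-dec _≟_ _≟_

  prodFin² : ∀ M N → (Fin M × Fin N → Carrier) → Carrier
  prodFin² M N g = prodFin M (λ i → prodFin N (λ p → g (i , p)))

  if-cong-then : ∀ b {x y z} → x ≈ y → (if b then x else z) ≈ (if b then y else z)
  if-cong-then true  x≈y = x≈y
  if-cong-then false _   = refl

  *-if : ∀ b {x} y → y * (if b then x else 0#) ≈ (if b then y * x else 0#)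
  *-if true  y = refl
  *-if false y = zeroʳ y

  prodFin²-1 : ∀ M N → prodFin² M N (λ _ → 1#) ≈ 1#
  prodFin²-1 M N = begin
    prodFin M (λ _ → prodFin N (λ _ → 1#)) ≈⟨ prodFin-cong M (λ _ → prodFin≈∏ N (λ _ → refl)) ⟩
    prodFin M (λ _ → ∏.sum {N} (λ _ → 1#)) ≈⟨ prodFin-cong M (λ _ → ∏.sum-replicate-zero N) ⟩
    prodFin M (λ _ → 1#)                   ≈⟨ prodFin≈∏ M (λ _ → refl) ⟩
    ∏.sum {M} (λ _ → 1#)                   ≈⟨ ∏.sum-replicate-zero M ⟩
    1#                                     ∎

  prodFin²-cong : ∀ M N {f g} → (∀ e → f e ≈ g e) → prodFin² M N f ≈ prodFin² M N g
  prodFin²-cong M N f≈g = prodFin-cong M (λ i → prodFin-cong N (λ p → f≈g (i , p)))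

  prodFin²-* : ∀ M N f g → prodFin² M N (λ e → f e * g e) ≈ prodFin² M N f * prodFin² M N g
  prodFin²-* M N f g = trans (prodFin-cong M (λ i → prodFin-* N _ _)) (prodFin-* M _ _)

  prodFin²-comm : ∀ M N (f : Fin M × Fin N → Fin M × Fin N → Carrier) →
                  prodFin² M N (λ e → prodFin² M N (f e)) ≈ prodFin² M N (λ e′ → prodFin² M N (λ e → f e e′))
  prodFin²-comm M N f = begin
    prodFin M (λ i → prodFin N (λ p → prodFin M (λ i′ → prodFin N (λ p′ → f (i , p) (i′ , p′)))))
      ≈⟨ prodFin-cong M (λ i → prodFin-comm N M _) ⟩
    prodFin M (λ i → prodFin M (λ i′ → prodFin N (λ p → prodFin N (λ p′ → f (i , p) (i′ , p′)))))
      ≈⟨ prodFin-comm M M _ ⟩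
    prodFin M (λ i′ → prodFin M (λ i → prodFin N (λ p → prodFin N (λ p′ → f (i , p) (i′ , p′)))))
      ≈⟨ prodFin-cong M (λ i′ → prodFin-cong M (λ i → prodFin-comm N N _)) ⟩
    prodFin M (λ i′ → prodFin M (λ i → prodFin N (λ p′ → prodFin N (λ p → f (i , p) (i′ , p′)))))
      ≈⟨ prodFin-cong M (λ i′ → prodFin-comm M N _) ⟩
    prodFin M (λ i′ → prodFin N (λ p′ → prodFin M (λ i → prodFin N (λ p → f (i , p) (i′ , p′))))) ∎

  prodFin²-δ : ∀ M N (e₀ : Fin M × Fin N) (f : Fin M × Fin N → Carrier) →
               prodFin² M N (λ e → if does (e ≟² e₀) then f e else 1#) ≈ f e₀
  prodFin²-δ M N (i₀ , p₀) f = begin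
    prodFin M (λ i → prodFin N (λ p → if does ((i , p) ≟² (i₀ , p₀)) then f (i , p) else 1#))
      ≈⟨ prodFin-cong M (λ i → prodFin-cong N (λ p → reflexive (reorder i p))) ⟩
    prodFin M (λ i → prodFin N (λ p → if does (p ≟ p₀) then (if does (i ≟ i₀) then f (i , p) else 1#) else 1#))
      ≈⟨ prodFin-cong M (λ i → prodFin-δ N p₀ _) ⟩
    prodFin M (λ i → if does (i ≟ i₀) then f (i , p₀) else 1#)
      ≈⟨ prodFin-δ M i₀ _ ⟩
    f (i₀ , p₀) ∎
    where
    reorder : ∀ i p → (if does ((i , p) ≟² (i₀ , p₀)) then f (i , p) else 1#)
                    ≡ (if does (p ≟ p₀) then (if does (i ≟ i₀) then f (i , p) else 1#) else 1#)
    reorder i p = ≡.trans (≡.cong (if_then f (i , p) else 1#)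
                            (does-⇔ (mk⇔ ,-injective (λ (i≡ , p≡) → ≡.cong₂ _,_ i≡ p≡))
                                    ((i , p) ≟² (i₀ , p₀)) (i ≟ i₀ ×-dec p ≟ p₀)))
                  (≡.trans (if-∧ (does (i ≟ i₀))) (if-swap-then (does (i ≟ i₀)) (does (p ≟ p₀))))

  prodFin²-indicator : ∀ M N {p} {P : Fin M × Fin N → Set p} (P? : ∀ e → Dec (P e)) f →
                prodFin² M N (λ e → if does (P? e) then f e else 0#)
                  ≈ (if does (all? λ i → all? λ p → P? (i , p)) then prodFin² M N f else 0#)
  prodFin²-indicator M N P? f =
    trans (prodFin-cong M (λ i → prodFin-indicator N (λ p → P? (i , p)) _)) (prodFin-indicator M _ _)

  prodFin²-const : ∀ M N a → prodFin² M N (λ _ → natR a) ≈ natR (a ℕ.^ (N ℕ.* M))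
  prodFin²-const M N a = begin
    prodFin M (λ _ → prodFin N (λ _ → natR a))  ≈⟨ prodFin-cong M (λ _ → prodFin-const N a) ⟩
    prodFin M (λ _ → natR (a ℕ.^ N))            ≈⟨ prodFin-const M (a ℕ.^ N) ⟩
    natR ((a ℕ.^ N) ℕ.^ M)                      ≡⟨ ≡.cong natR (ℕₚ.^-*-assoc a N M) ⟩
    natR (a ℕ.^ (N ℕ.* M))                      ∎

  record IsLinear {A : Set} (S : (A → Carrier) → Carrier) : Set (c ⊔ ℓ) where
    field
      cong    : ∀ {f g} → (∀ x → f x ≈ g x) → S f ≈ S g
      +-homo  : ∀ f g → S (λ x → f x + g x) ≈ S f + S g
      0#-homo : S (λ _ → 0#) ≈ 0#
      *-homo  : ∀ a f → S (λ x → a * f x) ≈ a * S f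

    if-homo : ∀ b f → S (λ x → if b then f x else 0#) ≈ (if b then S f else 0#)
    if-homo true  f = cong (λ _ → refl)
    if-homo false f = 0#-homo

    *-homoʳ : ∀ a f → S (λ x → f x * a) ≈ S f * a
    *-homoʳ a f = trans (cong (λ x → *-comm (f x) a)) (trans (*-homo a f) (*-comm a (S f)))

  open IsLinear

  sumFin-linear : ∀ N → IsLinear (sumFin N)
  sumFin-linear N = record
    { cong    = sumFin-cong N
    ; +-homo  = λ f g → begin
        sumFin N (λ i → f i + g i)  ≈⟨ sumFin≈∑ N (λ _ → refl) ⟩
        ∑.sum (λ i → f i + g i)     ≈⟨ ∑.∑-distrib-+ f g ⟩
        ∑.sum f + ∑.sum g           ≈⟨ +-cong (sumFin≈∑ N (λ _ → refl)) (sumFin≈∑ N (λ _ → refl)) ⟨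
        sumFin N f + sumFin N g     ∎
    ; 0#-homo = trans (sumFin≈∑ N (λ _ → refl)) (∑.sum-replicate-zero N)
    ; *-homo  = λ a f → begin
        sumFin N (λ i → a * f i)    ≈⟨ sumFin≈∑ N (λ _ → refl) ⟩
        ∑.sum (λ i → a * f i)       ≈⟨ ∑.*-distribˡ-sum a f ⟨
        a * ∑.sum f                 ≈⟨ *-congˡ (sumFin≈∑ N (λ _ → refl)) ⟨
        a * sumFin N f              ∎
    }

  sumFun-linear : ∀ {A : Set} N {S : (A → Carrier) → Carrier} → IsLinear S → IsLinear (sumFun N S)
  sumFun-linear zero    S-lin = record
    { cong = λ f≈g → f≈g _ ; +-homo = λ _ _ → refl ; 0#-homo = refl ; *-homo = λ _ _ → refl }
  sumFun-linear (suc N) S-lin = record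
    { cong    = λ f≈g → cong S-lin (λ x → cong IH (λ h → f≈g _))
    ; +-homo  = λ f g → trans (cong S-lin (λ x → +-homo IH _ _)) (+-homo S-lin _ _)
    ; 0#-homo = trans (cong S-lin (λ x → 0#-homo IH)) (0#-homo S-lin)
    ; *-homo  = λ a f → trans (cong S-lin (λ x → *-homo IH a _)) (*-homo S-lin a _)
    }
    where IH = sumFun-linear N S-lin

  sumPair : ∀ {A B : Set} → ((A → Carrier) → Carrier) → ((B → Carrier) → Carrier) →
            (A × B → Carrier) → Carrier
  sumPair S T g = S (λ x → T (λ y → g (x , y)))

  sumPair-linear : ∀ {A B : Set} {S : (A → Carrier) → Carrier} {T : (B → Carrier) → Carrier} →
                   IsLinear S → IsLinear T → IsLinear (sumPair S T)
  sumPair-linear S-lin T-lin = record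
    { cong    = λ f≈g → cong S-lin (λ x → cong T-lin (λ y → f≈g (x , y)))
    ; +-homo  = λ f g → trans (cong S-lin (λ x → +-homo T-lin _ _)) (+-homo S-lin _ _)
    ; 0#-homo = trans (cong S-lin (λ x → 0#-homo T-lin)) (0#-homo S-lin)
    ; *-homo  = λ a f → trans (cong S-lin (λ x → *-homo T-lin a _)) (*-homo S-lin a _)
    }

  sumFin-comm-linear : ∀ {B : Set} N {T : (B → Carrier) → Carrier} → IsLinear T →
                       (g : Fin N → B → Carrier) →
                       sumFin N (λ x → T (g x)) ≈ T (λ y → sumFin N (λ x → g x y))
  sumFin-comm-linear zero    T-lin g = sym (0#-homo T-lin)
  sumFin-comm-linear (suc N) T-lin g =
    trans (+-congˡ (sumFin-comm-linear N T-lin (g ∘ suc))) (sym (+-homo T-lin _ _))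

  sumFun-comm : ∀ {A B : Set} N {S : (A → Carrier) → Carrier} {T : (B → Carrier) → Carrier} →
                IsLinear S → (∀ (g : A → B → Carrier) → S (λ x → T (g x)) ≈ T (λ y → S (λ x → g x y))) →
                (g : (Fin N → A) → B → Carrier) →
                sumFun N S (λ ω → T (g ω)) ≈ T (λ y → sumFun N S (λ ω → g ω y))
  sumFun-comm zero    S-lin S-comm g = refl
  sumFun-comm (suc N) {T = T} S-lin S-comm g =
    trans (cong S-lin (λ x → sumFun-comm N {T = T} S-lin S-comm _)) (S-comm _)

  prodFin-sum : ∀ {A : Set} N {S : (A → Carrier) → Carrier} → IsLinear S →
                (φ : Fin N → A → Carrier) →
                prodFin N (λ i → S (φ i)) ≈ sumFun N S (λ f → prodFin N (λ i → φ i (f i)))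
  prodFin-sum zero    S-lin φ = refl
  prodFin-sum (suc N) {S} S-lin φ = begin
    S (φ zero) * prodFin N (λ i → S (φ (suc i)))
      ≈⟨ *-congˡ (prodFin-sum N S-lin (φ ∘ suc)) ⟩
    S (φ zero) * sumFun N S (λ h → prodFin N (λ i → φ (suc i) (h i)))
      ≈⟨ *-homoʳ S-lin _ (φ zero) ⟨
    S (λ x → φ zero x * sumFun N S (λ h → prodFin N (λ i → φ (suc i) (h i))))
      ≈⟨ cong S-lin (λ x → *-homo (sumFun-linear N S-lin) (φ zero x) _) ⟨
    sumFun (suc N) S (λ f → prodFin (suc N) (λ i → φ i (f i))) ∎

  sumList-tabulate : ∀ {A : Set} N (τ : Fin N → A) f → sumList (tabulate τ) f ≈ sumFin N (f ∘ τ)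
  sumList-tabulate N τ f = trans (MonoidSums.sumList-tabulate +-monoid N τ f) (sym (sumFin≈∑ N (λ _ → refl)))

  prodList-tabulate : ∀ {A : Set} N (τ : Fin N → A) f → ∏List.sumList (tabulate τ) f ≈ prodFin N (f ∘ τ)
  prodList-tabulate N τ f = trans (∏List.sumList-tabulate N τ f) (sym (prodFin≈∏ N (λ _ → refl)))

  sumList-indicator : ∀ {A : Set} {p} {Q : A → Set p} (Q? : ∀ x → Dec (Q x)) (xs : List A) a →
               sumList xs (λ x → if does (Q? x) then a else 0#) ≈ natR (length (filter Q? xs)) * a
  sumList-indicator Q? []       a = sym (zeroˡ a)
  sumList-indicator Q? (x ∷ xs) a with does (Q? x)
  ... | true  = trans (+-cong (sym (*-identityˡ a)) (sumList-indicator Q? xs a)) (sym (distribʳ _ _ _))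
  ... | false = trans (+-identityˡ _) (sumList-indicator Q? xs a)

  sumFin-indicator : ∀ N {p} {Q : Fin N → Set p} (Q? : ∀ x → Dec (Q x)) a →
              sumFin N (λ x → if does (Q? x) then a else 0#) ≈ natR (countFin N Q?) * a
  sumFin-indicator N Q? a = trans (sym (sumList-tabulate N (λ x → x) _)) (sumList-indicator Q? (allFin N) a)

  sumPair-cartesianProduct : ∀ M N g →
    sumPair (sumFin M) (sumFin N) g ≈ sumList (cartesianProduct (allFin M) (allFin N)) g
  sumPair-cartesianProduct M N g = sym (trans (go M (λ x → x)) (sumFin-cong M (λ v → sumList-tabulate N (λ y → y) _)))
    where
    go : ∀ K (τ : Fin K → Fin M) →
         sumList (cartesianProduct (tabulate τ) (allFin N)) g ≈ sumFin K (λ v → sumList (allFin N) (λ w → g (τ v , w)))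
    go zero    τ = refl
    go (suc K) τ = trans (sumList-++ (map (τ zero ,_) (allFin N)) _ g)
                         (+-cong (sumList-map (τ zero ,_) (allFin N) g) (go K (τ ∘ suc)))

  -- sumFun and allFuns extend functions by different pattern lambdas, hence the hypothesis on F.
  sumFun-allFuns : ∀ {A : Set} N {S : (A → Carrier) → Carrier} → IsLinear S → (xs : List A) →
                   (∀ g → S g ≈ sumList xs g) →
                   (F : (Fin N → A) → Carrier) → (∀ f g → (∀ i → f i ≡ g i) → F f ≈ F g) →
                   sumFun N S F ≈ sumList (allFuns N xs) F
  sumFun-allFuns zero    S-lin xs S≈ F F-ext = sym (+-identityʳ _)
  sumFun-allFuns (suc N) S-lin xs S≈ F F-ext =
    trans (cong S-lin (λ x → sumFun-allFuns N S-lin xs S≈ _ (λ f g f≗g →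
                               F-ext _ _ λ { zero → ≡.refl ; (suc i) → f≗g i })))
    (trans (S≈ _)
    (trans (sumList-cong xs (λ x →
              trans (sumList-cong (allFuns N xs) (λ h → F-ext _ _ λ { zero → ≡.refl ; (suc i) → ≡.refl }))
                    (sym (sumList-map _ (allFuns N xs) F))))
           (sym (sumList-concatMap _ xs F))))

module Characters {c ℓ} (R : CommutativeRing c ℓ) {d : ℕ} (𝒢 : WithRing.DiagGroup R d) where
  open CommutativeRing R hiding (zero)
  open WithRing R
  open DiagGroup 𝒢
  open BigOperators R
  open IsLinear
  open import Relation.Binary.Reasoning.Setoid setoid
  open import Algebra.Properties.CommutativeSemigroup *-commutativeSemigroup using (x∙yz≈y∙xz)

  χ : Fin d → Fin m → Carrier
  χ j x = elem x j

  χ-foldr : ∀ j {A : Set} (xs : List A) (g : A → Fin m) →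
            χ j (foldr mul one (map g xs)) ≈ ∏List.sumList xs (χ j ∘ g)
  χ-foldr j []       g = elem-one j
  χ-foldr j (x ∷ xs) g = trans (elem-mul _ _ j) (*-congˡ (χ-foldr j xs g))

  module _ {K n s : ℕ} (fam : Fin s → Fin n → Fin m) (indep : IndependentFamily 𝒢 K n s fam) (2≤K : 2 ≤ K) where

    private
      pair : ∀ {A : Set} → A → A → Fin 2 → A
      pair a b zero    = a
      pair a b (suc _) = b

      hits : Fin n → Fin n → Fin s → Fin m → Fin m → Set
      hits u u′ x g h = ∀ l → fam x (pair u u′ l) ≡ pair g h l

      hits? : ∀ u u′ x g h → Dec (hits u u′ x g h)
      hits? u u′ x g h = all? (λ l → fam x (pair u u′ l) ≟ pair g h l)

      count : Fin n → Fin n → Fin m → Fin m → ℕ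
      count u u′ g h = countFin s (λ x → hits? u u′ x g h)

      count-uniform : ∀ {u u′} → u ≢ u′ → ∀ g h → count u u′ g h ≡ count u u′ one one
      count-uniform {u} {u′} u≢u′ g h =
        ℕₚ.*-cancelʳ-≡ _ _ (m ℕ.^ 2) {{ℕₚ.m^n≢0 m 2 {{nonZeroIndex one}}}}
          (≡.trans (count×m²≡s g h) (≡.sym (count×m²≡s one one)))
        where
        distinct : ∀ l l′ → pair u u′ l ≡ pair u u′ l′ → l ≡ l′
        distinct zero       zero       _ = ≡.refl
        distinct zero       (suc zero) e = contradiction e u≢u′
        distinct (suc zero) zero       e = contradiction (≡.sym e) u≢u′
        distinct (suc zero) (suc zero) _ = ≡.refl
        count×m²≡s : ∀ g h → count u u′ g h ℕ.* m ℕ.^ 2 ≡ s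
        count×m²≡s g h = indep 2 2≤K (pair u u′) distinct (pair g h)

      hits⇔ : ∀ u u′ x g h → hits u u′ x g h ⇔ (g ≡ fam x u × h ≡ fam x u′)
      hits⇔ u u′ x g h = mk⇔ (λ hit → ≡.sym (hit zero) , ≡.sym (hit (suc zero)))
                              (λ { (g≡ , h≡) zero → ≡.sym g≡ ; (g≡ , h≡) (suc zero) → ≡.sym h≡ })

      sum-hits : ∀ u u′ x (F : Fin m → Fin m → Carrier) →
        sumFin m (λ g → sumFin m (λ h → if does (hits? u u′ x g h) then F g h else 0#)) ≈ F (fam x u) (fam x u′)
      sum-hits u u′ x F = begin
        sumFin m (λ g → sumFin m (λ h → if does (hits? u u′ x g h) then F g h else 0#))
          ≈⟨ sumFin-cong m (λ g → sumFin-cong m (λ h → reflexive (reorder g h))) ⟩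
        sumFin m (λ g → sumFin m (λ h → if does (h ≟ fam x u′) then (if does (g ≟ fam x u) then F g h else 0#) else 0#))
          ≈⟨ sumFin-cong m (λ g → sumFin-δ m (fam x u′) _) ⟩
        sumFin m (λ g → if does (g ≟ fam x u) then F g (fam x u′) else 0#)
          ≈⟨ sumFin-δ m (fam x u) _ ⟩
        F (fam x u) (fam x u′) ∎
        where
        reorder : ∀ g h → (if does (hits? u u′ x g h) then F g h else 0#)
                        ≡ (if does (h ≟ fam x u′) then (if does (g ≟ fam x u) then F g h else 0#) else 0#)
        reorder g h = ≡.trans (≡.cong (if_then F g h else 0#)
                                (does-⇔ (hits⇔ u u′ x g h) (hits? u u′ x g h) (g ≟ fam x u ×-dec h ≟ fam x u′)))
                     (≡.trans (if-∧ (does (g ≟ fam x u))) (if-swap-then (does (g ≟ fam x u)) (does (h ≟ fam x u′))))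

    -- Every (g , h) ∈ 𝒢² is hit by the same number of family members, so the sum is that
    -- number times (∑_g χ g)(∑_h χ h⁻¹), and ∑_g χ g = 0.
    ∑χχ⁻¹≈0 : ∀ j {u u′} → u ≢ u′ → sumFin s (λ x → χ j (fam x u) * χ j (inv (fam x u′))) ≈ 0#
    ∑χχ⁻¹≈0 j {u} {u′} u≢u′ = begin
      sumFin s (λ x → G (fam x u) (fam x u′))
        ≈⟨ sumFin-cong s (λ x → sum-hits u u′ x G) ⟨
      sumFin s (λ x → sumFin m (λ g → sumFin m (λ h → if does (hits? u u′ x g h) then G g h else 0#)))
        ≈⟨ sumFin-comm-linear s (sumPair-linear (sumFin-linear m) (sumFin-linear m)) _ ⟩
      sumFin m (λ g → sumFin m (λ h → sumFin s (λ x → if does (hits? u u′ x g h) then G g h else 0#)))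
        ≈⟨ sumFin-cong m (λ g → sumFin-cong m (λ h → sumFin-indicator s _ (G g h))) ⟩
      sumFin m (λ g → sumFin m (λ h → natR (count u u′ g h) * G g h))
        ≈⟨ sumFin-cong m (λ g → sumFin-cong m (λ h → *-congʳ (reflexive (≡.cong natR (count-uniform u≢u′ g h))))) ⟩
      sumFin m (λ g → sumFin m (λ h → κ * (χ j g * χ j (inv h))))
        ≈⟨ sumFin-cong m (λ g → sumFin-cong m (λ h → x∙yz≈y∙xz κ (χ j g) _)) ⟩
      sumFin m (λ g → sumFin m (λ h → χ j g * (κ * χ j (inv h))))
        ≈⟨ sumFin-cong m (λ g → *-homo (sumFin-linear m) (χ j g) _) ⟩
      sumFin m (λ g → χ j g * sumFin m (λ h → κ * χ j (inv h)))
        ≈⟨ *-homoʳ (sumFin-linear m) _ (χ j) ⟩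
      sumFin m (χ j) * sumFin m (λ h → κ * χ j (inv h))
        ≈⟨ *-congʳ (average-zero j) ⟩
      0# * sumFin m (λ h → κ * χ j (inv h))
        ≈⟨ zeroˡ _ ⟩
      0# ∎
      where
      G : Fin m → Fin m → Carrier
      G g h = χ j g * χ j (inv h)
      κ : Carrier
      κ = natR (count u u′ one one)

module DistinguishedIndex (H : OrientedGraph) (ι : Distinguished H) where

  ι₀ : End H → End H
  ι₀ e = proj₁ (ι (endpt H e))

  ι₀-endpt : ∀ e → endpt H (ι₀ e) ≡ endpt H e
  ι₀-endpt e = proj₂ (ι (endpt H e))

  ι₀-resp : ∀ e e′ → endpt H e ≡ endpt H e′ → ι₀ e ≡ ι₀ e′
  ι₀-resp _ _ = ≡.cong (proj₁ ∘ ι)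

module InjectiveHomomorphisms (H : OrientedGraph) (ι : Distinguished H) (G : SimpleGraph)
                              {C : ℕ} (col : Fin (SimpleGraph.n G) → Fin C) (cs : Fin (OrientedGraph.t H) → Fin C) where
  open OrientedGraph H
  open SimpleGraph G
  open DistinguishedIndex H ι

  Edge : Fin k → Fin n × Fin n → Set
  Edge i (v , w) = T (adj v w) × col v ≡ cs (src i) × col w ≡ cs (tgt i)

  edge? : ∀ i vw → Dec (Edge i vw)
  edge? i (v , w) = T? (adj v w) ×-dec col v ≟ cs (src i) ×-dec col w ≟ cs (tgt i)

  InducesHom : (Fin k → Fin n × Fin n) → Set
  InducesHom f = ∀ i p → vert H G col cs f (i , p) ≡ vert H G col cs f (ι₀ (i , p))

  inducesHom? : ∀ f → Dec (InducesHom f)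
  inducesHom? f = all? λ i → all? λ p → vert H G col cs f (i , p) ≟ vert H G col cs f (ι₀ (i , p))

  Good⇔Edge×InducesHom : Injective _≡_ _≡_ cs → ∀ f → Good H G col cs f ⇔ ((∀ i → Edge i (f i)) × InducesHom f)
  Good⇔Edge×InducesHom cs-inj f = mk⇔ to from
    where
    vt = vert H G col cs f
    to : Good H G col cs f → (∀ i → Edge i (f i)) × InducesHom f
    to (lands , compatible , injHom) =
      (λ i → Equivalence.from T-≡ (lands i) , compatible i zero , compatible i (suc zero)) ,
      (λ i p → proj₁ (injHom i p (proj₁ (ι₀ (i , p))) (proj₂ (ι₀ (i , p)))) (≡.sym (ι₀-endpt (i , p))))
    from : (∀ i → Edge i (f i)) × InducesHom f → Good H G col cs f
    from (edge , hom) = lands , compatible , injHom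
      where
      lands : LandsInG H G col cs f
      lands i = Equivalence.to T-≡ (proj₁ (edge i))
      compatible : Compatible H G col cs f
      compatible i zero       = proj₁ (proj₂ (edge i))
      compatible i (suc zero) = proj₂ (proj₂ (edge i))
      injHom : InducesInjHom H G col cs f
      injHom i p i′ p′ =
        (λ same → ≡.trans (hom i p) (≡.trans (≡.cong vt (ι₀-resp (i , p) (i′ , p′) same)) (≡.sym (hom i′ p′)))) ,
        (λ differ vt≡ → differ (cs-inj (≡.trans (≡.sym (compatible i p)) (≡.trans (≡.cong col vt≡) (compatible i′ p′)))))

  Good-resp : ∀ {f g} → (∀ i → f i ≡ g i) → Good H G col cs f → Good H G col cs g
  Good-resp {f} {g} f≗g (lands , compatible , injHom) =
    (λ i → ≡.subst (λ vw → adj (proj₁ vw) (proj₂ vw) ≡ true) (f≗g i) (lands i)) ,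
    (λ i p → ≡.trans (≡.cong col (≡.sym (vt≡ (i , p)))) (compatible i p)) ,
    (λ i p i′ p′ →
      (λ same → ≡.trans (≡.sym (vt≡ (i , p))) (≡.trans (proj₁ (injHom i p i′ p′) same) (vt≡ (i′ , p′)))) ,
      (λ differ eq → proj₂ (injHom i p i′ p′) differ (≡.trans (vt≡ (i , p)) (≡.trans eq (≡.sym (vt≡ (i′ , p′)))))))
    where
    vt≡ : ∀ e → vert H G col cs f e ≡ vert H G col cs g e
    vt≡ (i , zero)     = ≡.cong proj₁ (f≗g i)
    vt≡ (i , suc zero) = ≡.cong proj₂ (f≗g i)

module Hashing {c ℓ} (R : CommutativeRing c ℓ) {d : ℕ} (𝒢 : WithRing.DiagGroup R d)
               (H : OrientedGraph) (ι : Distinguished H) (G : SimpleGraph)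
               {s : ℕ} (fam : Fin s → Fin (SimpleGraph.n G) → Fin (WithRing.DiagGroup.m 𝒢))
               {C : ℕ} (col : Fin (SimpleGraph.n G) → Fin C) where
  open CommutativeRing R hiding (zero)
  open WithRing R
  open DiagGroup 𝒢
  open OrientedGraph H
  open SimpleGraph G
  open BigOperators R
  open Characters R 𝒢
  open DistinguishedIndex H ι
  open IsLinear
  open import Relation.Binary.Reasoning.Setoid setoid

  ∏ᴱ : (End H → Carrier) → Carrier
  ∏ᴱ = prodFin² k 2

  Choice : Set
  Choice = Fin k → Fin 2 → Fin s

  sumChoices : (Choice → Carrier) → Carrier
  sumChoices = sumFun k (sumFun 2 (sumFin s))

  sumChoices-linear : IsLinear sumChoices
  sumChoices-linear = sumFun-linear k (sumFun-linear 2 (sumFin-linear s))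

  Sibling : End H → End H → Set
  Sibling e e′ = endpt H e′ ≡ endpt H e × e′ ≢ e

  sibling? : ∀ e e′ → Dec (Sibling e e′)
  sibling? e e′ = endpt H e′ ≟ endpt H e ×-dec ¬? (e′ ≟E e)

  prodList-allEnds : ∀ g → ∏List.sumList (allEnds H) g ≈ ∏ᴱ g
  prodList-allEnds g = trans (∏List.sumList-concatMap _ (allFin k) g) (prodList-tabulate k (λ i → i) _)

  sibling-of-distinguished : ∀ e e′ → (e ≡ ι₀ e × Sibling e e′) ⇔ (e ≡ ι₀ e′ × e′ ≢ ι₀ e′)
  sibling-of-distinguished e e′ = mk⇔ to from
    where
    to : e ≡ ι₀ e × Sibling e e′ → e ≡ ι₀ e′ × e′ ≢ ι₀ e′
    to (e≡ι₀e , same , e′≢e) = e≡ι₀e′ , λ e′≡ι₀e′ → e′≢e (≡.trans e′≡ι₀e′ (≡.sym e≡ι₀e′))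
      where
      e≡ι₀e′ : e ≡ ι₀ e′
      e≡ι₀e′ = ≡.trans e≡ι₀e (ι₀-resp e e′ (≡.sym same))
    from : e ≡ ι₀ e′ × e′ ≢ ι₀ e′ → e ≡ ι₀ e × Sibling e e′
    from (e≡ι₀e′ , e′≢ι₀e′) = ≡.trans e≡ι₀e′ (ι₀-resp e′ e same) , same , λ e′≡e → e′≢ι₀e′ (≡.trans e′≡e e≡ι₀e′)
      where
      same : endpt H e′ ≡ endpt H e
      same = ≡.sym (≡.trans (≡.cong (endpt H) e≡ι₀e′) (ι₀-endpt e′))

  module _ (j : Fin d) (ω : End H → Fin s) where

    χ-hash-distinguished : ∀ e v → e ≡ ι₀ e →
      χ j (hash 𝒢 H ι G fam col ω e v) ≈ ∏ᴱ (λ e′ → if does (sibling? e e′) then χ j (inv (fam (ω e′) v)) else 1#)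
    χ-hash-distinguished e v e≡ι₀e with e ≟E ι₀ e
    ... | no e≢ι₀e = contradiction e≡ι₀e e≢ι₀e
    ... | yes _ = begin
      χ j (foldr mul one (map (λ e′ → inv (fam (ω e′) v)) (filter (λ e′ → ¬? (e′ ≟E e)) (Γ H (endpt H e)))))
        ≈⟨ χ-foldr j (filter (λ e′ → ¬? (e′ ≟E e)) (Γ H (endpt H e))) (λ e′ → inv (fam (ω e′) v)) ⟩
      ∏List.sumList (filter (λ e′ → ¬? (e′ ≟E e)) (Γ H (endpt H e))) X
        ≈⟨ ∏List.sumList-filter (λ e′ → ¬? (e′ ≟E e)) (Γ H (endpt H e)) X ⟩
      ∏List.sumList (Γ H (endpt H e)) (λ e′ → if does (¬? (e′ ≟E e)) then X e′ else 1#)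
        ≈⟨ ∏List.sumList-filter (λ e′ → endpt H e′ ≟ endpt H e) (allEnds H) (λ e′ → if does (¬? (e′ ≟E e)) then X e′ else 1#) ⟩
      ∏List.sumList (allEnds H) (λ e′ → if does (endpt H e′ ≟ endpt H e) then (if does (¬? (e′ ≟E e)) then X e′ else 1#) else 1#)
        ≈⟨ prodList-allEnds (λ e′ → if does (endpt H e′ ≟ endpt H e) then (if does (¬? (e′ ≟E e)) then X e′ else 1#) else 1#) ⟩
      ∏ᴱ (λ e′ → if does (endpt H e′ ≟ endpt H e) then (if does (¬? (e′ ≟E e)) then X e′ else 1#) else 1#)
        ≈⟨ prodFin²-cong k 2 (λ e′ → reflexive (≡.sym (if-∧ (does (endpt H e′ ≟ endpt H e)) {does (¬? (e′ ≟E e))} {X e′} {1#}))) ⟩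
      ∏ᴱ (λ e′ → if does (sibling? e e′) then X e′ else 1#) ∎
      where
      X : End H → Carrier
      X e′ = χ j (inv (fam (ω e′) v))

    hash-undistinguished : ∀ e v → e ≢ ι₀ e → hash 𝒢 H ι G fam col ω e v ≡ fam (ω e) v
    hash-undistinguished e v e≢ι₀e with e ≟E ι₀ e
    ... | yes e≡ι₀e = contradiction e≡ι₀e e≢ι₀e
    ... | no _      = ≡.refl

    χ-hash : ∀ e v → χ j (hash 𝒢 H ι G fam col ω e v)
           ≈ ∏ᴱ (λ e′ → if does (e ≟E ι₀ e ×-dec sibling? e e′) then χ j (inv (fam (ω e′) v)) else 1#)
             * (if does (e ≟E ι₀ e) then 1# else χ j (fam (ω e) v))
    χ-hash e v = by-cases (e ≟E ι₀ e)
      where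
      by-cases : (dist? : Dec (e ≡ ι₀ e)) → χ j (hash 𝒢 H ι G fam col ω e v)
        ≈ ∏ᴱ (λ e′ → if does (dist? ×-dec sibling? e e′) then χ j (inv (fam (ω e′) v)) else 1#)
          * (if does dist? then 1# else χ j (fam (ω e) v))
      by-cases (yes e≡ι₀e) = trans (χ-hash-distinguished e v e≡ι₀e) (sym (*-identityʳ _))
      by-cases (no e≢ι₀e)  = begin
        χ j (hash 𝒢 H ι G fam col ω e v)  ≡⟨ ≡.cong (χ j) (hash-undistinguished e v e≢ι₀e) ⟩
        χ j (fam (ω e) v)                 ≈⟨ *-identityˡ _ ⟨
        1# * χ j (fam (ω e) v)            ≈⟨ *-congʳ (prodFin²-1 k 2) ⟨
        ∏ᴱ (λ _ → 1#) * χ j (fam (ω e) v) ∎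

  module _ (j : Fin d) (vt : End H → Fin n) where

    ψ : End H → Fin s → Carrier
    ψ e x = if does (e ≟E ι₀ e) then 1# else χ j (fam x (vt e)) * χ j (inv (fam x (vt (ι₀ e))))

    -- Each factor χ (inv (fam (ω e′) v)) of a distinguished hash moves to the index e′ it
    -- comes from (collapse): the distinguished e is then ι₀ e′.
    regroup : ∀ ω → ∏ᴱ (λ e → χ j (hash 𝒢 H ι G fam col ω e (vt e))) ≈ ∏ᴱ (λ e → ψ e (ω e))
    regroup ω = begin
      ∏ᴱ (λ e → χ j (hash 𝒢 H ι G fam col ω e (vt e)))
        ≈⟨ prodFin²-cong k 2 (λ e → χ-hash j ω e (vt e)) ⟩
      ∏ᴱ (λ e → ∏ᴱ (K e) * B e)
        ≈⟨ prodFin²-* k 2 (λ e → ∏ᴱ (K e)) B ⟩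
      ∏ᴱ (λ e → ∏ᴱ (K e)) * ∏ᴱ B
        ≈⟨ *-congʳ (prodFin²-comm k 2 K) ⟩
      ∏ᴱ (λ e′ → ∏ᴱ (λ e → K e e′)) * ∏ᴱ B
        ≈⟨ *-congʳ (prodFin²-cong k 2 collapse) ⟩
      ∏ᴱ A * ∏ᴱ B
        ≈⟨ prodFin²-* k 2 A B ⟨
      ∏ᴱ (λ e → A e * B e)
        ≈⟨ prodFin²-cong k 2 (λ e → combine e (e ≟E ι₀ e)) ⟩
      ∏ᴱ (λ e → ψ e (ω e)) ∎
      where
      X : End H → End H → Carrier
      X e e′ = χ j (inv (fam (ω e′) (vt e)))
      K : End H → End H → Carrier
      K e e′ = if does (e ≟E ι₀ e ×-dec sibling? e e′) then X e e′ else 1#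
      A B : End H → Carrier
      A e = if does (¬? (e ≟E ι₀ e)) then X (ι₀ e) e else 1#
      B e = if does (e ≟E ι₀ e) then 1# else χ j (fam (ω e) (vt e))

      collapse : ∀ e′ → ∏ᴱ (λ e → K e e′) ≈ A e′
      collapse e′ = trans (prodFin²-cong k 2 (λ e → reflexive (reindex e)))
                          (prodFin²-δ k 2 (ι₀ e′) (λ e → if does (¬? (e′ ≟E ι₀ e′)) then X e e′ else 1#))
        where
        reindex : ∀ e → K e e′ ≡ (if does (e ≟E ι₀ e′) then (if does (¬? (e′ ≟E ι₀ e′)) then X e e′ else 1#) else 1#)
        reindex e = ≡.trans (≡.cong (if_then X e e′ else 1#)
                              (does-⇔ (sibling-of-distinguished e e′) (e ≟E ι₀ e ×-dec sibling? e e′)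
                                      (e ≟E ι₀ e′ ×-dec ¬? (e′ ≟E ι₀ e′))))
                            (if-∧ (does (e ≟E ι₀ e′)))

      combine : ∀ e (dist? : Dec (e ≡ ι₀ e)) →
        (if does (¬? dist?) then X (ι₀ e) e else 1#) * (if does dist? then 1# else χ j (fam (ω e) (vt e)))
          ≈ (if does dist? then 1# else χ j (fam (ω e) (vt e)) * X (ι₀ e) e)
      combine e (yes _) = *-identityʳ 1#
      combine e (no _)  = *-comm _ _

    sum-ψ : ∀ {K} → IndependentFamily 𝒢 K n s fam → 2 ≤ K → ∀ e →
            sumFin s (ψ e) ≈ (if does (vt e ≟ vt (ι₀ e)) then natR s else 0#)
    sum-ψ indep 2≤K e = by-cases (e ≟E ι₀ e) (vt e ≟ vt (ι₀ e))
      where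
      by-cases : (dist? : Dec (e ≡ ι₀ e)) (same? : Dec (vt e ≡ vt (ι₀ e))) →
        sumFin s (λ x → if does dist? then 1# else χ j (fam x (vt e)) * χ j (inv (fam x (vt (ι₀ e)))))
          ≈ (if does same? then natR s else 0#)
      by-cases (yes _)      (yes _)     = trans (sumFin-const s 1#) (*-identityʳ _)
      by-cases (yes e≡ι₀e)  (no differ) = contradiction (≡.cong vt e≡ι₀e) differ
      by-cases (no _)       (yes same)  = begin
        sumFin s (λ x → χ j (fam x (vt e)) * χ j (inv (fam x (vt (ι₀ e)))))
          ≈⟨ sumFin-cong s (λ x → reflexive (≡.cong (λ v → χ j (fam x (vt e)) * χ j (inv (fam x v))) (≡.sym same))) ⟩
        sumFin s (λ x → χ j (fam x (vt e)) * χ j (inv (fam x (vt e))))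
          ≈⟨ sumFin-cong s (λ x → elem-inv (fam x (vt e)) j) ⟩
        sumFin s (λ _ → 1#)
          ≈⟨ sumFin-const s 1# ⟩
        natR s * 1#
          ≈⟨ *-identityʳ _ ⟩
        natR s ∎
      by-cases (no _)       (no differ) = ∑χχ⁻¹≈0 fam indep 2≤K j differ

    expected-monomial : IndependentFamily 𝒢 (4 ℕ.* k) n s fam →
      sumChoices (λ ω′ → ∏ᴱ (λ e → χ j (hash 𝒢 H ι G fam col (λ e → ω′ (proj₁ e) (proj₂ e)) e (vt e))))
        ≈ (if does (all? λ i → all? λ p → vt (i , p) ≟ vt (ι₀ (i , p))) then natR (s ℕ.^ (2 ℕ.* k)) else 0#)
    expected-monomial indep = begin
      sumChoices (λ ω′ → ∏ᴱ (λ e → χ j (hash 𝒢 H ι G fam col (λ e → ω′ (proj₁ e) (proj₂ e)) e (vt e))))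
        ≈⟨ cong sumChoices-linear (λ ω′ → regroup (λ e → ω′ (proj₁ e) (proj₂ e))) ⟩
      sumChoices (λ ω′ → prodFin k (λ i → prodFin 2 (λ p → ψ (i , p) (ω′ i p))))
        ≈⟨ prodFin-sum k SA-linear (λ i g → prodFin 2 (λ p → ψ (i , p) (g p))) ⟨
      prodFin k (λ i → sumFun 2 (sumFin s) (λ g → prodFin 2 (λ p → ψ (i , p) (g p))))
        ≈⟨ prodFin-cong k (λ i → prodFin-sum 2 (sumFin-linear s) (λ p → ψ (i , p))) ⟨
      ∏ᴱ (λ e → sumFin s (ψ e))
        ≈⟨ prodFin²-cong k 2 (λ e → sum-ψ indep (2≤4k (proj₁ e)) e) ⟩
      ∏ᴱ (λ e → if does (vt e ≟ vt (ι₀ e)) then natR s else 0#)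
        ≈⟨ prodFin²-indicator k 2 (λ e → vt e ≟ vt (ι₀ e)) (λ _ → natR s) ⟩
      (if does (all? λ i → all? λ p → vt (i , p) ≟ vt (ι₀ (i , p))) then ∏ᴱ (λ _ → natR s) else 0#)
        ≈⟨ if-cong-then (does (all? λ i → all? λ p → vt (i , p) ≟ vt (ι₀ (i , p)))) (prodFin²-const k 2 s) ⟩
      (if does (all? λ i → all? λ p → vt (i , p) ≟ vt (ι₀ (i , p))) then natR (s ℕ.^ (2 ℕ.* k)) else 0#) ∎
      where
      SA-linear : IsLinear (sumFun 2 (sumFin s))
      SA-linear = sumFun-linear 2 (sumFin-linear s)
      2≤4k : Fin k → 2 ≤ 4 ℕ.* k
      2≤4k i = ℕₚ.≤-trans (ℕₚ.m≤n+m 2 2) (ℕₚ.m≤m*n 4 k {{nonZeroIndex i}})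

module TraceExpectation {c ℓ} (R : CommutativeRing c ℓ) {d : ℕ} (𝒢 : WithRing.DiagGroup R d)
                        (H : OrientedGraph) (ι : Distinguished H) (G : SimpleGraph)
                        {s : ℕ} (fam : Fin s → Fin (SimpleGraph.n G) → Fin (WithRing.DiagGroup.m 𝒢))
                        (indep : WithRing.IndependentFamily R 𝒢 (4 ℕ.* OrientedGraph.k H) (SimpleGraph.n G) s fam)
                        {C : ℕ} (col : Fin (SimpleGraph.n G) → Fin C) (cs : Fin (OrientedGraph.t H) → Fin C) where
  open CommutativeRing R hiding (zero)
  open WithRing R
  open OrientedGraph H
  open SimpleGraph G
  open BigOperators R
  open IsLinear
  open Hashing R 𝒢 H ι G fam col
  open InjectiveHomomorphisms H ι G col cs
  open import Relation.Binary.Reasoning.Setoid setoid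

  Map : Set
  Map = Fin k → Fin n × Fin n

  sumMaps : (Map → Carrier) → Carrier
  sumMaps = sumFun k (sumPair (sumFin n) (sumFin n))

  sumMaps-linear : IsLinear sumMaps
  sumMaps-linear = sumFun-linear k (sumPair-linear (sumFin-linear n) (sumFin-linear n))

  sumChoices-comm : ∀ {B : Set} {T : (B → Carrier) → Carrier} → IsLinear T → (g : Choice → B → Carrier) →
                    sumChoices (λ ω′ → T (g ω′)) ≈ T (λ y → sumChoices (λ ω′ → g ω′ y))
  sumChoices-comm {T = T} T-linear = sumFun-comm k {T = T} (sumFun-linear 2 (sumFin-linear s))
                                       (sumFun-comm 2 {T = T} (sumFin-linear s) (sumFin-comm-linear s T-linear))

  monomial : Choice → Fin d → Map → Carrier
  monomial ω′ j f = prodFin k (λ i →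
    if does (edge? i (f i)) then 𝓜 𝒢 H ι G fam col (λ e → ω′ (proj₁ e) (proj₂ e)) i (proj₁ (f i)) (proj₂ (f i)) j else 0#)

  sumTr𝒮-expand : sumTr𝒮 𝒢 H ι G fam col cs ≈ sumMaps (λ f → sumFin d (λ j → sumChoices (λ ω′ → monomial ω′ j f)))
  sumTr𝒮-expand = begin
    sumChoices (λ ω′ → sumFin d (λ j → prodFin k (λ i → sumPair (sumFin n) (sumFin n) (λ vw →
      if does (edge? i vw) then 𝓜 𝒢 H ι G fam col (λ e → ω′ (proj₁ e) (proj₂ e)) i (proj₁ vw) (proj₂ vw) j else 0#))))
      ≈⟨ cong sumChoices-linear (λ ω′ → sumFin-cong d (λ j → prodFin-sum k (sumPair-linear (sumFin-linear n) (sumFin-linear n)) _)) ⟩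
    sumChoices (λ ω′ → sumFin d (λ j → sumMaps (monomial ω′ j)))
      ≈⟨ sumChoices-comm (sumFin-linear d) _ ⟩
    sumFin d (λ j → sumChoices (λ ω′ → sumMaps (monomial ω′ j)))
      ≈⟨ sumFin-cong d (λ j → sumChoices-comm sumMaps-linear _) ⟩
    sumFin d (λ j → sumMaps (λ f → sumChoices (λ ω′ → monomial ω′ j f)))
      ≈⟨ sumFin-comm-linear d sumMaps-linear _ ⟩
    sumMaps (λ f → sumFin d (λ j → sumChoices (λ ω′ → monomial ω′ j f))) ∎

  expected-monomial-at : ∀ f j → sumChoices (λ ω′ → monomial ω′ j f)
    ≈ (if does (all? λ i → edge? i (f i)) then (if does (inducesHom? f) then natR (s ℕ.^ (2 ℕ.* k)) else 0#) else 0#)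
  expected-monomial-at f j = begin
    sumChoices (λ ω′ → monomial ω′ j f)
      ≈⟨ cong sumChoices-linear (λ ω′ → prodFin-indicator k (λ i → edge? i (f i)) _) ⟩
    sumChoices (λ ω′ → if does (all? λ i → edge? i (f i)) then prodFin k (λ i → χ′ ω′ (i , zero) * χ′ ω′ (i , suc zero)) else 0#)
      ≈⟨ cong sumChoices-linear (λ ω′ → if-cong-then (does (all? λ i → edge? i (f i)))
                                           (prodFin-cong k (λ i → *-congˡ (sym (*-identityʳ _))))) ⟩
    sumChoices (λ ω′ → if does (all? λ i → edge? i (f i)) then ∏ᴱ (λ e → χ′ ω′ e) else 0#)
      ≈⟨ if-homo sumChoices-linear (does (all? λ i → edge? i (f i))) _ ⟩
    (if does (all? λ i → edge? i (f i)) then sumChoices (λ ω′ → ∏ᴱ (λ e → χ′ ω′ e)) else 0#)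
      ≈⟨ if-cong-then (does (all? λ i → edge? i (f i))) (expected-monomial j (vert H G col cs f) indep) ⟩
    (if does (all? λ i → edge? i (f i)) then (if does (inducesHom? f) then natR (s ℕ.^ (2 ℕ.* k)) else 0#) else 0#) ∎
    where
    open Characters R 𝒢 using (χ)
    χ′ : Choice → End H → Carrier
    χ′ ω′ e = χ j (hash 𝒢 H ι G fam col (λ e → ω′ (proj₁ e) (proj₂ e)) e (vert H G col cs f e))

  expected-trace-at : Injective _≡_ _≡_ cs → ∀ f → sumFin d (λ j → sumChoices (λ ω′ → monomial ω′ j f))
    ≈ (if does (good? H G col cs f) then natR d * natR (s ℕ.^ (2 ℕ.* k)) else 0#)
  expected-trace-at cs-inj f = begin
    sumFin d (λ j → sumChoices (λ ω′ → monomial ω′ j f))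
      ≈⟨ sumFin-cong d (expected-monomial-at f) ⟩
    sumFin d (λ _ → if does edges? then (if does (inducesHom? f) then x else 0#) else 0#)
      ≈⟨ sumFin-const d _ ⟩
    natR d * (if does edges? then (if does (inducesHom? f) then x else 0#) else 0#)
      ≡⟨ ≡.cong (natR d *_) (if-∧ (does edges?)) ⟨
    natR d * (if does (edges? ×-dec inducesHom? f) then x else 0#)
      ≈⟨ *-if (does (edges? ×-dec inducesHom? f)) (natR d) ⟩
    (if does (edges? ×-dec inducesHom? f) then natR d * x else 0#)
      ≡⟨ ≡.cong (if_then natR d * x else 0#) (does-⇔ (Good⇔Edge×InducesHom cs-inj f) (good? H G col cs f) (edges? ×-dec inducesHom? f)) ⟨
    (if does (good? H G col cs f) then natR d * x else 0#) ∎
    where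
    edges? = all? λ i → edge? i (f i)
    x = natR (s ℕ.^ (2 ℕ.* k))

  sumMaps-good : ∀ a → sumMaps (λ f → if does (good? H G col cs f) then a else 0#) ≈ natR (numGood H G col cs) * a
  sumMaps-good a =
    trans (sumFun-allFuns k (sumPair-linear (sumFin-linear n) (sumFin-linear n)) (cartesianProduct (allFin n) (allFin n))
                          (sumPair-cartesianProduct n n) _ respects-≗)
          (sumList-indicator (good? H G col cs) (allFuns k (cartesianProduct (allFin n) (allFin n))) a)
    where
    respects-≗ : ∀ f g → (∀ i → f i ≡ g i) → (if does (good? H G col cs f) then a else 0#) ≈ (if does (good? H G col cs g) then a else 0#)
    respects-≗ f g f≗g = reflexive (≡.cong (if_then a else 0#)
      (does-⇔ (mk⇔ (Good-resp f≗g) (Good-resp (≡.sym ∘ f≗g))) (good? H G col cs f) (good? H G col cs g)))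

  sumTr𝒮≈numGood : Injective _≡_ _≡_ cs →
    sumTr𝒮 𝒢 H ι G fam col cs ≈ natR (s ℕ.^ (2 ℕ.* k) ℕ.* d ℕ.* numGood H G col cs)
  sumTr𝒮≈numGood cs-inj = begin
    sumTr𝒮 𝒢 H ι G fam col cs
      ≈⟨ sumTr𝒮-expand ⟩
    sumMaps (λ f → sumFin d (λ j → sumChoices (λ ω′ → monomial ω′ j f)))
      ≈⟨ cong sumMaps-linear (expected-trace-at cs-inj) ⟩
    sumMaps (λ f → if does (good? H G col cs f) then natR d * natR s²ᵏ else 0#)
      ≈⟨ sumMaps-good _ ⟩
    natR (numGood H G col cs) * (natR d * natR s²ᵏ)
      ≈⟨ *-comm _ _ ⟩
    (natR d * natR s²ᵏ) * natR (numGood H G col cs)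
      ≈⟨ *-congʳ (*-comm _ _) ⟩
    (natR s²ᵏ * natR d) * natR (numGood H G col cs)
      ≈⟨ *-congʳ (natR-* s²ᵏ d) ⟨
    natR (s²ᵏ ℕ.* d) * natR (numGood H G col cs)
      ≈⟨ natR-* (s²ᵏ ℕ.* d) (numGood H G col cs) ⟨
    natR (s²ᵏ ℕ.* d ℕ.* numGood H G col cs) ∎
    where
    s²ᵏ = s ℕ.^ (2 ℕ.* k)

open import Data.Nat using (_*_; _^_)

lemma2p3 : ∀ {c ℓ : Level} (R : CommutativeRing c ℓ)
    (H : OrientedGraph) → IsSimple H → Connected H → NoLeaves H →
    (ι : Distinguished H) →
    (G : SimpleGraph) →
    (d : ℕ) (𝒢 : WithRing.DiagGroup R d) →
    (s : ℕ) (fam : Fin s → Fin (SimpleGraph.n G) → Fin (WithRing.DiagGroup.m 𝒢)) →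
    WithRing.IndependentFamily R 𝒢 (4 * OrientedGraph.k H) (SimpleGraph.n G) s fam →
    (C : ℕ) → OrientedGraph.t H ≤ C →
    (col : Fin (SimpleGraph.n G) → Fin C) →
    (cs : Fin (OrientedGraph.t H) → Fin C) → Injective _≡_ _≡_ cs →
    CommutativeRing._≈_ R
      (WithRing.sumTr𝒮 R 𝒢 H ι G fam col cs)
      (WithRing.natR R (s ^ (2 * OrientedGraph.k H) * d * numGood H G col cs))
lemma2p3 R H _ _ _ ι G d 𝒢 s fam indep C _ col cs cs-inj =
  TraceExpectation.sumTr𝒮≈numGood R 𝒢 H ι G fam indep col cs cs-inj
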